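{- Let $M$ be a matroid with finite ground set $E$. Then \[\sum_{A\subseteq E}h_{|E-A|-1}\,\tilde\beta(M/A)\ \ge\ 0.\]
   Context: For a matroid $N$ on ground set $S$ with rank function $r$, the beta invariant is $\beta(N)=(-1)^{r(N)}\sum_{X\subseteq S}(-1)^{|X|}r(X)$, where $r(N)=r(S)$, and the signed beta invariant is $\tilde\beta(N)=(-1)^{r(N)+1}\beta(N)$. $M/A$ denotes the contraction of $M$ by $A$ (a matroid on $E-A$). $h_i=1+\frac12+\dots+\frac1i$ for $i\ge1$, and $h_i=0$ for $i\le0$. -}

module Defs where

open import Data.Bool using (Bool; true; false; if_then_else_)
open import Data.Nat as ℕ using (ℕ; zero; suc; _∸_)
open import Data.Integer as ℤ using (ℤ; +_; -[1+_]; +[1+_])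
open import Data.Rational as ℚ using (ℚ)
open import Data.List using (List; []; _∷_; [_]; map; _++_; foldr)
open import Data.Vec using ([]; _∷_)
open import Data.Fin.Subset using (Subset; inside; outside; _⊆_; _∪_; _∩_; _─_; ⊤; ∣_∣)
open import Data.Fin.Subset.Properties using (_⊆?_)
open import Relation.Nullary.Decidable using (⌊_⌋)

record Matroid (n : ℕ) : Set where
  field
    r         : Subset n → ℕ
    r-bounded : ∀ X → r X ℕ.≤ ∣ X ∣
    r-mono    : ∀ {X Y} → X ⊆ Y → r X ℕ.≤ r Y
    r-submod  : ∀ X Y → r (X ∪ Y) ℕ.+ r (X ∩ Y) ℕ.≤ r X ℕ.+ r Y

subsets : (n : ℕ) → List (Subset n)
subsets zero    = [ [] ]
subsets (suc n) = map (outside ∷_) (subsets n) ++ map (inside ∷_) (subsets n)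

sumℤ⊆ : {n : ℕ} → Subset n → (Subset n → ℤ) → ℤ
sumℤ⊆ {n} G f = foldr (λ X acc → (if ⌊ X ⊆? G ⌋ then f X else + 0) ℤ.+ acc) (+ 0) (subsets n)

sumℚ : {n : ℕ} → (Subset n → ℚ) → ℚ
sumℚ {n} f = foldr (λ X acc → f X ℚ.+ acc) ℚ.0ℚ (subsets n)

sign : ℕ → ℤ
sign zero          = + 1
sign (suc zero)    = ℤ.- (+ 1)
sign (suc (suc k)) = sign k

-- A matroid on ground set G ⊆ Fin n, presented by a rank function ρ on subsets of G.
-- Beta invariant: β = (-1)^{ρ(G)} Σ_{X ⊆ G} (-1)^{|X|} ρ(X).
beta : {n : ℕ} → (G : Subset n) → (ρ : Subset n → ℕ) → ℤ
beta G ρ = sign (ρ G) ℤ.* sumℤ⊆ G (λ X → sign ∣ X ∣ ℤ.* (+ ρ X))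

signedBeta : {n : ℕ} → (G : Subset n) → (ρ : Subset n → ℕ) → ℤ
signedBeta G ρ = sign (suc (ρ G)) ℤ.* beta G ρ

contractGround : {n : ℕ} → Subset n → Subset n
contractGround A = ⊤ ─ A

contractRank : {n : ℕ} → Matroid n → Subset n → Subset n → ℕ
contractRank M A X = Matroid.r M (X ∪ A) ∸ Matroid.r M A

signedBetaContract : {n : ℕ} → Matroid n → Subset n → ℤ
signedBetaContract M A = signedBeta (contractGround A) (contractRank M A)

harmonicℕ : ℕ → ℚ
harmonicℕ zero    = ℚ.0ℚ
harmonicℕ (suc k) = harmonicℕ k ℚ.+ (+ 1) ℚ./ suc k

h : ℤ → ℚ
h (+ k)      = harmonicℕ k
h -[1+ _ ]   = ℚ.0ℚ

toℚ : ℤ → ℚ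
toℚ z = z ℚ./ 1

-- Write φ k = h_{k-1} and Δ^y φ (j) = Σᵢ (-1)ⁱ C(y,i) φ(j+i). Expanding
-- β̃(M/A) = -Σ_{X ⊆ E-A} (-1)^|X| (r(X ∪ A) - r(A)) and collecting the coefficient
-- of each r(Y) turns the sum into -Σ_Y r(Y) Δ^{|Y|} φ(|E-Y|); the r(A) terms drop
-- out because φ(0) = 0. The differences of harmonic numbers are Beta integrals,
-- Δ^{a+1} φ(b+1) = -a! b! / (a+b+1)!, so the coefficients are symmetric under
-- Y ↦ E-Y, sum to φ(0) = 0, and are nonpositive unless Y = ∅ or Y = E. Symmetrising,
-- twice Σ_Y r(Y) Δ^{|Y|} φ(|E-Y|) equals Σ_Y λ(Y) Δ^{|Y|} φ(|E-Y|) for the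
-- connectivity function λ(Y) = r(Y) + r(E-Y) - r(E), which is nonnegative by
-- submodularity and vanishes at ∅ and E; hence every term is ≤ 0.

module Submission where

open import Defs
open import Data.Nat using (ℕ)
open import Data.Integer using (+_; _-_)
open import Data.Rational using (0ℚ; _≤_; _*_)
open import Data.Fin.Subset using (⊤; _─_; ∣_∣)

open import Data.Bool using (true; false; if_then_else_)
open import Data.Nat as ℕ using (zero; suc; _!)
import Data.Nat.Properties as ℕP
import Data.Nat.Solver
import Data.Integer as ℤ
import Data.Integer.Properties as ℤP
open import Data.Rational as ℚ using (ℚ; 1ℚ; _+_; -_) renaming (_-_ to _−_)
import Data.Rational.Properties as ℚP
import Data.Rational.Unnormalised as ℚᵘ
import Data.Rational.Unnormalised.Properties as ℚᵘP
import Data.Rational.Solver as ℚSolver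
open import Data.List using (List; foldr; map; _++_)
import Data.List.Properties as ListP
open import Data.Vec using ([]; _∷_)
open import Data.Fin.Subset using (Subset; inside; outside; _∪_; _∩_; ⊥)
open import Data.Fin.Subset.Properties using (_⊆?_; p─⊥≡p; q⊆p∪q; ∣⊥∣≡0)
open import Relation.Nullary.Decidable using (⌊_⌋; ⌊⌋-map′)
open import Relation.Binary.PropositionalEquality
open import Function using (_∘_)
open import Algebra.Bundles using (CommutativeMonoid)
open import Algebra.Properties.CommutativeSemigroup
  (CommutativeMonoid.commutativeSemigroup ℚP.+-0-commutativeMonoid)
  using () renaming (interchange to +-interchange)

open ℚSolver.+-*-Solver using (solve; con; _:+_; _:*_; :-_; _:-_; _:=_)
module ℕSolver = Data.Nat.Solver.+-*-Solver

toℚᵘ-toℚ : ∀ z → ℚ.toℚᵘ (toℚ z) ℚᵘ.≃ ℚᵘ.mkℚᵘ z 0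
toℚᵘ-toℚ z = ℚP.toℚᵘ-fromℚᵘ (ℚᵘ.mkℚᵘ z 0)

toℚ-homo-+ : ∀ a b → toℚ (a ℤ.+ b) ≡ toℚ a + toℚ b
toℚ-homo-+ a b = ℚP.toℚᵘ-injective (ℚᵘP.≃-trans (toℚᵘ-toℚ (a ℤ.+ b))
  (ℚᵘP.≃-trans (ℚᵘ.*≡* cross) (ℚᵘP.≃-sym (ℚᵘP.≃-trans (ℚP.toℚᵘ-homo-+ (toℚ a) (toℚ b))
    (ℚᵘP.+-cong (toℚᵘ-toℚ a) (toℚᵘ-toℚ b))))))
  where
  cross : (a ℤ.+ b) ℤ.* + 1 ≡ (a ℤ.* + 1 ℤ.+ b ℤ.* + 1) ℤ.* + 1
  cross rewrite ℤP.*-identityʳ a | ℤP.*-identityʳ b | ℤP.*-identityʳ (a ℤ.+ b) = refl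

toℚ-homo-* : ∀ a b → toℚ (a ℤ.* b) ≡ toℚ a * toℚ b
toℚ-homo-* a b = ℚP.toℚᵘ-injective (ℚᵘP.≃-trans (toℚᵘ-toℚ (a ℤ.* b))
  (ℚᵘP.≃-sym (ℚᵘP.≃-trans (ℚP.toℚᵘ-homo-* (toℚ a) (toℚ b))
    (ℚᵘP.*-cong (toℚᵘ-toℚ a) (toℚᵘ-toℚ b)))))

toℚ-homo‿- : ∀ a → toℚ (ℤ.- a) ≡ - toℚ a
toℚ-homo‿- a = ℚP.toℚᵘ-injective (ℚᵘP.≃-trans (toℚᵘ-toℚ (ℤ.- a))
  (ℚᵘP.≃-sym (ℚᵘP.≃-trans (ℚP.toℚᵘ-homo‿- (toℚ a)) (ℚᵘP.-‿cong (toℚᵘ-toℚ a)))))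

⟦_⟧ : ℕ → ℚ
⟦ m ⟧ = toℚ (+ m)

⟦⟧-+ : ∀ m n → ⟦ m ℕ.+ n ⟧ ≡ ⟦ m ⟧ + ⟦ n ⟧
⟦⟧-+ m n = toℚ-homo-+ (+ m) (+ n)

⟦⟧-* : ∀ m n → ⟦ m ℕ.* n ⟧ ≡ ⟦ m ⟧ * ⟦ n ⟧
⟦⟧-* m n = trans (cong toℚ (ℤP.pos-* m n)) (toℚ-homo-* (+ m) (+ n))

⟦⟧-∸ : ∀ {m n} → n ℕ.≤ m → ⟦ m ℕ.∸ n ⟧ ≡ ⟦ m ⟧ − ⟦ n ⟧
⟦⟧-∸ {m} {n} n≤m = begin
  ⟦ m ℕ.∸ n ⟧                       ≡⟨ add-sub ⟦ m ℕ.∸ n ⟧ ⟦ n ⟧ ⟩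
  (⟦ m ℕ.∸ n ⟧ + ⟦ n ⟧) − ⟦ n ⟧      ≡⟨ cong (_− ⟦ n ⟧) (sym (⟦⟧-+ (m ℕ.∸ n) n)) ⟩
  ⟦ m ℕ.∸ n ℕ.+ n ⟧ − ⟦ n ⟧          ≡⟨ cong (λ k → ⟦ k ⟧ − ⟦ n ⟧) (ℕP.m∸n+n≡m n≤m) ⟩
  ⟦ m ⟧ − ⟦ n ⟧                     ∎
  where
  open ≡-Reasoning
  add-sub : ∀ x y → x ≡ (x + y) − y
  add-sub = solve 2 (λ x y → x := (x :+ y) :- y) refl

⟦⟧-nonNeg : ∀ m → ℚ.NonNegative ⟦ m ⟧
⟦⟧-nonNeg m = ℚP.normalize-nonNeg m 1

⟦!⟧-pos : ∀ m → ℚ.Positive ⟦ m ! ⟧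
⟦!⟧-pos m = ℚP.normalize-pos (m !) 1 {{_}} {{m ℕP.!≢0}}

*-cancelʳ-≡-pos : ∀ {p q} r .{{_ : ℚ.Positive r}} → p * r ≡ q * r → p ≡ q
*-cancelʳ-≡-pos r pr≡qr = ℚP.≤-antisym (ℚP.*-cancelʳ-≤-pos r (ℚP.≤-reflexive pr≡qr))
                                       (ℚP.*-cancelʳ-≤-pos r (ℚP.≤-reflexive (sym pr≡qr)))

Σ⊆ : ∀ {n} → Subset n → (Subset n → ℚ) → ℚ
Σ⊆ []            f = f []
Σ⊆ (outside ∷ G) f = Σ⊆ G (λ X → f (outside ∷ X))
Σ⊆ (inside  ∷ G) f = Σ⊆ G (λ X → f (outside ∷ X)) + Σ⊆ G (λ X → f (inside ∷ X))

Σall : ∀ {n} → (Subset n → ℚ) → ℚ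
Σall = Σ⊆ ⊤

Σ⊆-cong : ∀ {n} (G : Subset n) {f g : Subset n → ℚ} → (∀ X → f X ≡ g X) → Σ⊆ G f ≡ Σ⊆ G g
Σ⊆-cong []            f≗g = f≗g []
Σ⊆-cong (outside ∷ G) f≗g = Σ⊆-cong G (λ X → f≗g (outside ∷ X))
Σ⊆-cong (inside  ∷ G) f≗g = cong₂ _+_ (Σ⊆-cong G (λ X → f≗g (outside ∷ X)))
                                      (Σ⊆-cong G (λ X → f≗g (inside ∷ X)))

Σ⊆-zero : ∀ {n} (G : Subset n) {f : Subset n → ℚ} → (∀ X → f X ≡ 0ℚ) → Σ⊆ G f ≡ 0ℚ
Σ⊆-zero []            f≗0 = f≗0 []
Σ⊆-zero (outside ∷ G) f≗0 = Σ⊆-zero G (λ X → f≗0 (outside ∷ X))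
Σ⊆-zero (inside  ∷ G) f≗0 = cong₂ _+_ (Σ⊆-zero G (λ X → f≗0 (outside ∷ X)))
                                      (Σ⊆-zero G (λ X → f≗0 (inside ∷ X)))

Σ⊆-+ : ∀ {n} (G : Subset n) (f g : Subset n → ℚ) → Σ⊆ G (λ X → f X + g X) ≡ Σ⊆ G f + Σ⊆ G g
Σ⊆-+ []            f g = refl
Σ⊆-+ (outside ∷ G) f g = Σ⊆-+ G _ _
Σ⊆-+ (inside  ∷ G) f g = trans
  (cong₂ _+_ (Σ⊆-+ G (λ X → f (outside ∷ X)) (λ X → g (outside ∷ X)))
             (Σ⊆-+ G (λ X → f (inside ∷ X)) (λ X → g (inside ∷ X))))
  (+-interchange (Σ⊆ G (f ∘ (outside ∷_))) (Σ⊆ G (g ∘ (outside ∷_)))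
                 (Σ⊆ G (f ∘ (inside ∷_))) (Σ⊆ G (g ∘ (inside ∷_))))

Σ⊆-neg : ∀ {n} (G : Subset n) (f : Subset n → ℚ) → Σ⊆ G (λ X → - f X) ≡ - Σ⊆ G f
Σ⊆-neg []            f = refl
Σ⊆-neg (outside ∷ G) f = Σ⊆-neg G _
Σ⊆-neg (inside  ∷ G) f = trans
  (cong₂ _+_ (Σ⊆-neg G (λ X → f (outside ∷ X))) (Σ⊆-neg G (λ X → f (inside ∷ X))))
  (sym (ℚP.neg-distrib-+ (Σ⊆ G (f ∘ (outside ∷_))) (Σ⊆ G (f ∘ (inside ∷_)))))

Σ⊆-− : ∀ {n} (G : Subset n) (f g : Subset n → ℚ) → Σ⊆ G (λ X → f X − g X) ≡ Σ⊆ G f − Σ⊆ G g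
Σ⊆-− G f g = trans (Σ⊆-+ G f (λ X → - g X)) (cong (_+_ (Σ⊆ G f)) (Σ⊆-neg G g))

Σ⊆-*ˡ : ∀ {n} (G : Subset n) c (f : Subset n → ℚ) → Σ⊆ G (λ X → c * f X) ≡ c * Σ⊆ G f
Σ⊆-*ˡ []            c f = refl
Σ⊆-*ˡ (outside ∷ G) c f = Σ⊆-*ˡ G c _
Σ⊆-*ˡ (inside  ∷ G) c f = trans
  (cong₂ _+_ (Σ⊆-*ˡ G c (λ X → f (outside ∷ X))) (Σ⊆-*ˡ G c (λ X → f (inside ∷ X))))
  (sym (ℚP.*-distribˡ-+ c _ _))

Σ⊆-nonPos : ∀ {n} (G : Subset n) (f : Subset n → ℚ) → (∀ X → f X ≤ 0ℚ) → Σ⊆ G f ≤ 0ℚ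
Σ⊆-nonPos []            f f≤0 = f≤0 []
Σ⊆-nonPos (outside ∷ G) f f≤0 = Σ⊆-nonPos G _ (λ X → f≤0 (outside ∷ X))
Σ⊆-nonPos (inside  ∷ G) f f≤0 = ℚP.+-mono-≤ {_} {0ℚ} {_} {0ℚ}
  (Σ⊆-nonPos G _ (λ X → f≤0 (outside ∷ X))) (Σ⊆-nonPos G _ (λ X → f≤0 (inside ∷ X)))

⊤─⊤─p≡p : ∀ {n} (p : Subset n) → ⊤ ─ (⊤ ─ p) ≡ p
⊤─⊤─p≡p []            = refl
⊤─⊤─p≡p (outside ∷ p) = cong (outside ∷_) (⊤─⊤─p≡p p)
⊤─⊤─p≡p (inside  ∷ p) = cong (inside ∷_) (⊤─⊤─p≡p p)

p∪⊤─p≡⊤ : ∀ {n} (p : Subset n) → p ∪ (⊤ ─ p) ≡ ⊤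
p∪⊤─p≡⊤ []            = refl
p∪⊤─p≡⊤ (outside ∷ p) = cong (inside ∷_) (p∪⊤─p≡⊤ p)
p∪⊤─p≡⊤ (inside  ∷ p) = cong (inside ∷_) (p∪⊤─p≡⊤ p)

∣p∣≡0⇒p≡⊥ : ∀ {n} (p : Subset n) → ∣ p ∣ ≡ 0 → p ≡ ⊥
∣p∣≡0⇒p≡⊥ []            _     = refl
∣p∣≡0⇒p≡⊥ (outside ∷ p) ∣p∣≡0 = cong (outside ∷_) (∣p∣≡0⇒p≡⊥ p ∣p∣≡0)

Σall-complement : ∀ {n} (f : Subset n → ℚ) → Σall (λ Y → f (⊤ ─ Y)) ≡ Σall f
Σall-complement {zero}  f = refl
Σall-complement {suc n} f = trans
  (cong₂ _+_ (Σall-complement (λ Y → f (inside ∷ Y))) (Σall-complement (λ Y → f (outside ∷ Y))))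
  (ℚP.+-comm (Σall (f ∘ (inside ∷_))) (Σall (f ∘ (outside ∷_))))

Σall-filter : ∀ {n} (G : Subset n) (f : Subset n → ℚ) →
              Σall (λ X → if ⌊ X ⊆? G ⌋ then f X else 0ℚ) ≡ Σ⊆ G f
Σall-filter []            f = refl
Σall-filter {suc n} (outside ∷ G) f = trans
  (cong₂ _+_ (trans (Σ⊆-cong ⊤ (λ X → cong (λ b → if b then f (outside ∷ X) else 0ℚ) (⌊⌋-map′ _ _ (X ⊆? G))))
                    (Σall-filter G _))
             (Σ⊆-zero (⊤ {n}) (λ _ → refl)))
  (ℚP.+-identityʳ _)
Σall-filter (inside  ∷ G) f = cong₂ _+_
  (trans (Σ⊆-cong ⊤ (λ X → cong (λ b → if b then f (outside ∷ X) else 0ℚ) (⌊⌋-map′ _ _ (X ⊆? G))))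
         (Σall-filter G _))
  (trans (Σ⊆-cong ⊤ (λ X → cong (λ b → if b then f (inside ∷ X) else 0ℚ) (⌊⌋-map′ _ _ (X ⊆? G))))
         (Σall-filter G _))

foldr-+-init : ∀ {A : Set} (f : A → ℚ) c xs →
               foldr (λ x acc → f x + acc) c xs ≡ foldr (λ x acc → f x + acc) 0ℚ xs + c
foldr-+-init f c xs = trans
  (cong (λ e → foldr (λ x acc → f x + acc) e xs) (sym (ℚP.+-identityˡ c)))
  (sym (ListP.foldr-fusion (_+ c) 0ℚ (λ x y → ℚP.+-assoc (f x) y c) xs))

sumℚ≡Σall : ∀ {n} (f : Subset n → ℚ) → sumℚ f ≡ Σall f
sumℚ≡Σall {zero}  f = ℚP.+-identityʳ (f [])
sumℚ≡Σall {suc n} f = begin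
  foldr F 0ℚ (map (outside ∷_) S ++ map (inside ∷_) S)
    ≡⟨ ListP.foldr-++ F 0ℚ (map (outside ∷_) S) (map (inside ∷_) S) ⟩
  foldr F (foldr F 0ℚ (map (inside ∷_) S)) (map (outside ∷_) S)
    ≡⟨ foldr-+-init f _ (map (outside ∷_) S) ⟩
  foldr F 0ℚ (map (outside ∷_) S) + foldr F 0ℚ (map (inside ∷_) S)
    ≡⟨ cong₂ _+_ (trans (ListP.foldr-map F (outside ∷_) 0ℚ S) (sumℚ≡Σall (f ∘ (outside ∷_))))
                 (trans (ListP.foldr-map F (inside ∷_) 0ℚ S) (sumℚ≡Σall (f ∘ (inside ∷_)))) ⟩
  Σall f ∎
  where
  open ≡-Reasoning
  S : List (Subset n)
  S = subsets n
  F : Subset (suc n) → ℚ → ℚ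
  F X acc = f X + acc

toℚ-sumℤ⊆ : ∀ {n} (G : Subset n) (f : Subset n → ℤ.ℤ) → toℚ (sumℤ⊆ G f) ≡ Σ⊆ G (toℚ ∘ f)
toℚ-sumℤ⊆ {n} G f = begin
  toℚ (foldr (λ X acc → fG X ℤ.+ acc) (+ 0) (subsets n))
    ≡⟨ ListP.foldr-fusion toℚ (+ 0) (λ X acc → toℚ-homo-+ (fG X) acc) (subsets n) ⟩
  sumℚ (toℚ ∘ fG)
    ≡⟨ sumℚ≡Σall (toℚ ∘ fG) ⟩
  Σall (toℚ ∘ fG)
    ≡⟨ Σ⊆-cong ⊤ (λ X → toℚ-if ⌊ X ⊆? G ⌋ (f X)) ⟩
  Σall (λ X → if ⌊ X ⊆? G ⌋ then toℚ (f X) else 0ℚ)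
    ≡⟨ Σall-filter G (toℚ ∘ f) ⟩
  Σ⊆ G (toℚ ∘ f) ∎
  where
  open ≡-Reasoning
  fG : Subset n → ℤ.ℤ
  fG X = if ⌊ X ⊆? G ⌋ then f X else + 0
  toℚ-if : ∀ b z → toℚ (if b then z else + 0) ≡ (if b then toℚ z else 0ℚ)
  toℚ-if true  z = refl
  toℚ-if false z = refl

sign-flip : ∀ k z → sign (suc k) ℤ.* (sign k ℤ.* z) ≡ ℤ.- z
sign-flip zero          z = trans (ℤP.-1*i≡-i _) (cong ℤ.-_ (ℤP.*-identityˡ z))
sign-flip (suc zero)    z = trans (ℤP.*-identityˡ _) (ℤP.-1*i≡-i z)
sign-flip (suc (suc k)) z = sign-flip k z

signedBeta≡-alternating : ∀ {n} (G : Subset n) ρ →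
                          signedBeta G ρ ≡ ℤ.- sumℤ⊆ G (λ X → sign ∣ X ∣ ℤ.* + ρ X)
signedBeta≡-alternating G ρ = sign-flip (ρ G) _

σ : ℕ → ℚ
σ k = toℚ (sign k)

σ-suc : ∀ k x → σ (suc k) * x ≡ - (σ k * x)
σ-suc k x = trans (cong (λ s → toℚ s * x) (sign-suc k))
                  (trans (cong (_* x) (toℚ-homo‿- (sign k))) (sym (ℚP.neg-distribˡ-* (σ k) x)))
  where
  sign-suc : ∀ k → sign (suc k) ≡ ℤ.- sign k
  sign-suc zero          = refl
  sign-suc (suc zero)    = refl
  sign-suc (suc (suc k)) = sign-suc k

Δ : (ℕ → ℚ) → ℕ → ℕ → ℚ
Δ φ zero    j = φ j
Δ φ (suc y) j = Δ φ y j − Δ φ y (suc j)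

Δ-shift : ∀ φ y j → Δ (φ ∘ suc) y j ≡ Δ φ y (suc j)
Δ-shift φ zero    j = refl
Δ-shift φ (suc y) j = cong₂ _−_ (Δ-shift φ y j) (Δ-shift φ y (suc j))

κ : ∀ {n} → (ℕ → ℚ) → Subset n → ℚ
κ φ Y = Δ φ ∣ Y ∣ ∣ ⊤ ─ Y ∣

Σall-κ : ∀ {n} φ → Σall {n} (κ φ) ≡ φ 0
Σall-κ {zero}  φ = refl
Σall-κ {suc n} φ = begin
  Σall κ⁺ + Σall (λ Y → κ₀ Y − κ⁺ Y)  ≡⟨ cong (_+_ (Σall κ⁺)) (Σ⊆-− ⊤ κ₀ κ⁺) ⟩
  Σall κ⁺ + (Σall κ₀ − Σall κ⁺)      ≡⟨ telescope (Σall κ⁺) (Σall κ₀) ⟩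
  Σall κ₀                            ≡⟨ Σall-κ {n} φ ⟩
  φ 0                                ∎
  where
  open ≡-Reasoning
  κ₀ κ⁺ : Subset n → ℚ
  κ₀ = κ φ
  κ⁺ Y = Δ φ ∣ Y ∣ (suc ∣ ⊤ ─ Y ∣)
  telescope : ∀ a b → a + (b − a) ≡ b
  telescope = solve 2 (λ a b → a :+ (b :- a) := b) refl

alternatingSum : ∀ {n} → (ℕ → ℚ) → (Subset n → ℚ) → ℚ
alternatingSum φ f = Σall (λ A → φ ∣ ⊤ ─ A ∣ * Σ⊆ (⊤ ─ A) (λ X → σ ∣ X ∣ * f (X ∪ A)))

*-distribˡ-− : ∀ c a b → c * (a − b) ≡ c * a − c * b
*-distribˡ-− = solve 3 (λ c a b → c :* (a :- b) := c :* a :- c :* b) refl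

alternatingSum-suc : ∀ {n} φ (f : Subset (suc n) → ℚ) →
  alternatingSum φ f ≡ (alternatingSum (φ ∘ suc) (f ∘ (outside ∷_)) − alternatingSum (φ ∘ suc) (f ∘ (inside ∷_)))
                       + alternatingSum φ (f ∘ (inside ∷_))
alternatingSum-suc {n} φ f = cong (_+ alternatingSum φ f₁) (begin
  Σall (λ A → φ′ A * (S f₀ A + Σ⊆ (⊤ ─ A) (λ X → σ (suc ∣ X ∣) * f₁ (X ∪ A))))
    ≡⟨ Σ⊆-cong ⊤ (λ A → cong (λ s → φ′ A * (S f₀ A + s)) (flip-signs A)) ⟩
  Σall (λ A → φ′ A * (S f₀ A − S f₁ A))
    ≡⟨ Σ⊆-cong ⊤ (λ A → *-distribˡ-− (φ′ A) (S f₀ A) (S f₁ A)) ⟩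
  Σall (λ A → φ′ A * S f₀ A − φ′ A * S f₁ A)
    ≡⟨ Σ⊆-− ⊤ (λ A → φ′ A * S f₀ A) (λ A → φ′ A * S f₁ A) ⟩
  alternatingSum (φ ∘ suc) f₀ − alternatingSum (φ ∘ suc) f₁ ∎)
  where
  open ≡-Reasoning
  f₀ f₁ : Subset n → ℚ
  f₀ = f ∘ (outside ∷_)
  f₁ = f ∘ (inside ∷_)
  φ′ : Subset n → ℚ
  φ′ A = φ (suc ∣ ⊤ ─ A ∣)
  S : (Subset n → ℚ) → Subset n → ℚ
  S g A = Σ⊆ (⊤ ─ A) (λ X → σ ∣ X ∣ * g (X ∪ A))
  flip-signs : ∀ A → Σ⊆ (⊤ ─ A) (λ X → σ (suc ∣ X ∣) * f₁ (X ∪ A)) ≡ - S f₁ A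
  flip-signs A = trans (Σ⊆-cong (⊤ ─ A) (λ X → σ-suc ∣ X ∣ (f₁ (X ∪ A))))
                       (Σ⊆-neg (⊤ ─ A) (λ X → σ ∣ X ∣ * f₁ (X ∪ A)))

alternatingSum-coefficients : ∀ {n} φ (f : Subset n → ℚ) → alternatingSum φ f ≡ Σall (λ Y → f Y * κ φ Y)
alternatingSum-coefficients {zero}  φ f = p*[1*x]≡x*p (φ 0) (f [])
  where
  p*[1*x]≡x*p : ∀ p x → p * (1ℚ * x) ≡ x * p
  p*[1*x]≡x*p = solve 2 (λ p x → p :* (con 1ℚ :* x) := x :* p) refl
alternatingSum-coefficients {suc n} φ f = begin
  alternatingSum φ f
    ≡⟨ alternatingSum-suc φ f ⟩
  (alternatingSum (φ ∘ suc) f₀ − alternatingSum (φ ∘ suc) f₁) + alternatingSum φ f₁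
    ≡⟨ cong₂ (λ a b → (a − b) + alternatingSum φ f₁)
             (trans (alternatingSum-coefficients (φ ∘ suc) f₀) (Σ⊆-cong ⊤ (shift f₀)))
             (trans (alternatingSum-coefficients (φ ∘ suc) f₁) (Σ⊆-cong ⊤ (shift f₁))) ⟩
  (Σall (λ Y → f₀ Y * κ⁺ Y) − Σall (λ Y → f₁ Y * κ⁺ Y)) + alternatingSum φ f₁
    ≡⟨ cong (_+_ (Σall (λ Y → f₀ Y * κ⁺ Y) − Σall (λ Y → f₁ Y * κ⁺ Y))) (alternatingSum-coefficients φ f₁) ⟩
  (Σall (λ Y → f₀ Y * κ⁺ Y) − Σall (λ Y → f₁ Y * κ⁺ Y)) + Σall (λ Y → f₁ Y * κ φ Y)
    ≡⟨ regroup (Σall (λ Y → f₀ Y * κ⁺ Y)) (Σall (λ Y → f₁ Y * κ⁺ Y)) (Σall (λ Y → f₁ Y * κ φ Y)) ⟩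
  Σall (λ Y → f₀ Y * κ⁺ Y) + (Σall (λ Y → f₁ Y * κ φ Y) − Σall (λ Y → f₁ Y * κ⁺ Y))
    ≡⟨ cong (_+_ (Σall (λ Y → f₀ Y * κ⁺ Y))) (sym (trans
         (Σ⊆-cong ⊤ (λ Y → *-distribˡ-− (f₁ Y) (κ φ Y) (κ⁺ Y)))
         (Σ⊆-− ⊤ (λ Y → f₁ Y * κ φ Y) (λ Y → f₁ Y * κ⁺ Y)))) ⟩
  Σall (λ Y → f₀ Y * κ⁺ Y) + Σall (λ Y → f₁ Y * (κ φ Y − κ⁺ Y)) ∎
  where
  open ≡-Reasoning
  f₀ f₁ κ⁺ : Subset n → ℚ
  f₀ = f ∘ (outside ∷_)
  f₁ = f ∘ (inside ∷_)
  κ⁺ Y = Δ φ ∣ Y ∣ (suc ∣ ⊤ ─ Y ∣)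
  shift : ∀ g Y → g Y * κ (φ ∘ suc) Y ≡ g Y * κ⁺ Y
  shift g Y = cong (g Y *_) (Δ-shift φ ∣ Y ∣ ∣ ⊤ ─ Y ∣)
  regroup : ∀ a b c → (a − b) + c ≡ a + (c − b)
  regroup = solve 3 (λ a b c → (a :- b) :+ c := a :+ (c :- b)) refl

Σ⊆-alternating-inside : ∀ {n} (G : Subset n) c → Σ⊆ (inside ∷ G) (λ X → σ ∣ X ∣ * c) ≡ 0ℚ
Σ⊆-alternating-inside G c = trans
  (cong (_+_ (Σ⊆ G (λ X → σ ∣ X ∣ * c)))
        (trans (Σ⊆-cong G (λ X → σ-suc ∣ X ∣ c)) (Σ⊆-neg G (λ X → σ ∣ X ∣ * c))))
  (ℚP.+-inverseʳ (Σ⊆ G (λ X → σ ∣ X ∣ * c)))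

weighted-alternating-constant : ∀ {n} (φ : ℕ → ℚ) → φ 0 ≡ 0ℚ → (G : Subset n) (c : ℚ) →
                                φ ∣ G ∣ * Σ⊆ G (λ X → σ ∣ X ∣ * c) ≡ 0ℚ
weighted-alternating-constant φ φ0≡0 []            c = trans (cong (_* (σ 0 * c)) φ0≡0) (ℚP.*-zeroˡ (σ 0 * c))
weighted-alternating-constant φ φ0≡0 (outside ∷ G) c = weighted-alternating-constant φ φ0≡0 G c
weighted-alternating-constant φ φ0≡0 (inside  ∷ G) c =
  trans (cong (φ (suc ∣ G ∣) *_) (Σ⊆-alternating-inside G c)) (ℚP.*-zeroʳ (φ (suc ∣ G ∣)))

φh : ℕ → ℚ
φh k = h (+ k - + 1)

1/[1+k]*[1+k]≡1 : ∀ k → ((+ 1) ℚ./ suc k) * ⟦ suc k ⟧ ≡ 1ℚ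
1/[1+k]*[1+k]≡1 k = ℚP.toℚᵘ-injective (ℚᵘP.≃-trans (ℚP.toℚᵘ-homo-* ((+ 1) ℚ./ suc k) ⟦ suc k ⟧)
  (ℚᵘP.≃-trans (ℚᵘP.*-cong (ℚP.toℚᵘ-fromℚᵘ (ℚᵘ.mkℚᵘ (+ 1) k)) (toℚᵘ-toℚ (+ suc k)))
               (ℚᵘP.*-inverseˡ (ℚᵘ.mkℚᵘ (+ suc k) 0))))

Δφh-oneˡ : ∀ b → Δ φh 1 (suc b) * ⟦ suc b ! ⟧ ≡ - ⟦ b ! ⟧
Δφh-oneˡ b = begin
  (H − (H + u)) * ⟦ suc b ℕ.* b ! ⟧   ≡⟨ cong ((H − (H + u)) *_) (⟦⟧-* (suc b) (b !)) ⟩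
  (H − (H + u)) * (⟦ suc b ⟧ * B)      ≡⟨ harmonic-step H u ⟦ suc b ⟧ B ⟩
  - ((u * ⟦ suc b ⟧) * B)              ≡⟨ cong (λ x → - (x * B)) (1/[1+k]*[1+k]≡1 b) ⟩
  - (1ℚ * B)                           ≡⟨ cong -_ (ℚP.*-identityˡ B) ⟩
  - B                                  ∎
  where
  open ≡-Reasoning
  H u B : ℚ
  H = harmonicℕ b
  u = (+ 1) ℚ./ suc b
  B = ⟦ b ! ⟧
  harmonic-step : ∀ H u s B → (H − (H + u)) * (s * B) ≡ - ((u * s) * B)
  harmonic-step = solve 4 (λ H u s B → (H :- (H :+ u)) :* (s :* B) := :- ((u :* s) :* B)) refl

β-recurrence : ∀ a b → suc (suc (a ℕ.+ b)) ℕ.* (a ! ℕ.* b !) ≡ a ! ℕ.* suc b ! ℕ.+ suc a ! ℕ.* b !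
β-recurrence a b = ℕSolver.solve 4
  (λ a b A B → (ℕSolver.con 2 ℕSolver.:+ a ℕSolver.:+ b) ℕSolver.:* (A ℕSolver.:* B)
      ℕSolver.:= A ℕSolver.:* ((ℕSolver.con 1 ℕSolver.:+ b) ℕSolver.:* B)
                 ℕSolver.:+ ((ℕSolver.con 1 ℕSolver.:+ a) ℕSolver.:* A) ℕSolver.:* B)
  refl a b (a !) (b !)

difference-step : ∀ d₁ d₂ c N P Q R → d₁ * N ≡ - P → d₂ * (c * N) ≡ - Q → c * P ≡ Q + R →
                  (d₁ − d₂) * (c * N) ≡ - R
difference-step d₁ d₂ c N P Q R d₁N d₂cN cP = begin
  (d₁ − d₂) * (c * N)           ≡⟨ expand d₁ d₂ c N ⟩
  c * (d₁ * N) − d₂ * (c * N)   ≡⟨ cong₂ (λ x y → c * x − y) d₁N d₂cN ⟩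
  c * - P − - Q                 ≡⟨ swap c P Q ⟩
  Q − c * P                     ≡⟨ cong (Q −_) cP ⟩
  Q − (Q + R)                   ≡⟨ cancel Q R ⟩
  - R                           ∎
  where
  open ≡-Reasoning
  expand : ∀ d₁ d₂ c N → (d₁ − d₂) * (c * N) ≡ c * (d₁ * N) − d₂ * (c * N)
  expand = solve 4 (λ d₁ d₂ c N → (d₁ :- d₂) :* (c :* N) := c :* (d₁ :* N) :- d₂ :* (c :* N)) refl
  swap : ∀ c P Q → c * - P − - Q ≡ Q − c * P
  swap = solve 3 (λ c P Q → c :* (:- P) :- (:- Q) := Q :- c :* P) refl
  cancel : ∀ Q R → Q − (Q + R) ≡ - R
  cancel = solve 2 (λ Q R → Q :- (Q :+ R) := :- R) refl

Δφh-closed : ∀ a b → Δ φh (suc a) (suc b) * ⟦ suc (a ℕ.+ b) ! ⟧ ≡ - ⟦ a ! ℕ.* b ! ⟧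
Δφh-closed zero    b = trans (Δφh-oneˡ b) (cong (λ m → - ⟦ m ⟧) (sym (ℕP.*-identityˡ (b !))))
Δφh-closed (suc a) b = trans (cong (Δ φh (suc (suc a)) (suc b) *_) (⟦⟧-* (suc s) (s !)))
  (difference-step (Δ φh (suc a) (suc b)) (Δ φh (suc a) (suc (suc b))) ⟦ suc s ⟧ ⟦ s ! ⟧
                   ⟦ a ! ℕ.* b ! ⟧ ⟦ a ! ℕ.* suc b ! ⟧ ⟦ suc a ! ℕ.* b ! ⟧
                   (Δφh-closed a b) shifted recurrence)
  where
  s : ℕ
  s = suc (a ℕ.+ b)
  shifted : Δ φh (suc a) (suc (suc b)) * (⟦ suc s ⟧ * ⟦ s ! ⟧) ≡ - ⟦ a ! ℕ.* suc b ! ⟧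
  shifted = trans (cong (Δ φh (suc a) (suc (suc b)) *_) (sym (⟦⟧-* (suc s) (s !))))
                  (trans (cong (λ m → Δ φh (suc a) (suc (suc b)) * ⟦ suc m ! ⟧) (sym (ℕP.+-suc a b)))
                         (Δφh-closed a (suc b)))
  recurrence : ⟦ suc s ⟧ * ⟦ a ! ℕ.* b ! ⟧ ≡ ⟦ a ! ℕ.* suc b ! ⟧ + ⟦ suc a ! ℕ.* b ! ⟧
  recurrence = trans (sym (⟦⟧-* (suc s) (a ! ℕ.* b !)))
                     (trans (cong ⟦_⟧ (β-recurrence a b)) (⟦⟧-+ (a ! ℕ.* suc b !) (suc a ! ℕ.* b !)))

Δφh-nonPos : ∀ a b → Δ φh (suc a) (suc b) ≤ 0ℚ
Δφh-nonPos a b = ℚP.*-cancelʳ-≤-pos ⟦ suc (a ℕ.+ b) ! ⟧ {{⟦!⟧-pos (suc (a ℕ.+ b))}} (begin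
  Δ φh (suc a) (suc b) * ⟦ suc (a ℕ.+ b) ! ⟧  ≡⟨ Δφh-closed a b ⟩
  - ⟦ a ! ℕ.* b ! ⟧                          ≤⟨ ℚP.neg-antimono-≤ (ℚP.nonNegative⁻¹ _ {{⟦⟧-nonNeg (a ! ℕ.* b !)}}) ⟩
  0ℚ                                         ≡⟨ ℚP.*-zeroˡ ⟦ suc (a ℕ.+ b) ! ⟧ ⟨
  0ℚ * ⟦ suc (a ℕ.+ b) ! ⟧                   ∎)
  where open ℚP.≤-Reasoning

Δφh-sym-suc : ∀ a b → Δ φh (suc a) (suc b) ≡ Δ φh (suc b) (suc a)
Δφh-sym-suc a b = *-cancelʳ-≡-pos ⟦ suc (a ℕ.+ b) ! ⟧ {{⟦!⟧-pos (suc (a ℕ.+ b))}} (begin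
  Δ φh (suc a) (suc b) * ⟦ suc (a ℕ.+ b) ! ⟧  ≡⟨ Δφh-closed a b ⟩
  - ⟦ a ! ℕ.* b ! ⟧                          ≡⟨ cong (λ m → - ⟦ m ⟧) (ℕP.*-comm (a !) (b !)) ⟩
  - ⟦ b ! ℕ.* a ! ⟧                          ≡⟨ Δφh-closed b a ⟨
  Δ φh (suc b) (suc a) * ⟦ suc (b ℕ.+ a) ! ⟧  ≡⟨ cong (λ m → Δ φh (suc b) (suc a) * ⟦ suc m ! ⟧) (ℕP.+-comm b a) ⟩
  Δ φh (suc b) (suc a) * ⟦ suc (a ℕ.+ b) ! ⟧  ∎)
  where open ≡-Reasoning

Δφh-zeroʳ : ∀ y → Δ φh y 0 ≡ φh y
Δφh-zeroʳ zero    = refl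
Δφh-zeroʳ (suc y) = trans (cong₂ _−_ (Δφh-zeroʳ y) (Δφh-oneʳ y)) (x−[x−z]≡z (φh y) (φh (suc y)))
  where
  Δφh-oneʳ : ∀ y → Δ φh y 1 ≡ φh y − φh (suc y)
  Δφh-oneʳ zero    = refl
  Δφh-oneʳ (suc a) = Δφh-sym-suc a 0
  x−[x−z]≡z : ∀ x z → x − (x − z) ≡ z
  x−[x−z]≡z = solve 2 (λ x z → x :- (x :- z) := z) refl

Δφh-sym : ∀ a b → Δ φh a b ≡ Δ φh b a
Δφh-sym zero    zero    = refl
Δφh-sym zero    (suc b) = sym (Δφh-zeroʳ (suc b))
Δφh-sym (suc a) zero    = Δφh-zeroʳ (suc a)
Δφh-sym (suc a) (suc b) = Δφh-sym-suc a b

κφh-complement : ∀ {n} (Y : Subset n) → κ φh (⊤ ─ Y) ≡ κ φh Y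
κφh-complement Y = trans (cong (Δ φh ∣ ⊤ ─ Y ∣ ∘ ∣_∣) (⊤─⊤─p≡p Y)) (Δφh-sym ∣ ⊤ ─ Y ∣ ∣ Y ∣)

module _ {n : ℕ} (M : Matroid n) where
  open Matroid M

  κh : Subset n → ℚ
  κh = κ φh

  rankTransform : ℚ
  rankTransform = Σall (λ Y → ⟦ r Y ⟧ * κh Y)

  toℚ-signedBetaContract : ∀ A → toℚ (signedBetaContract M A) ≡
                           - Σ⊆ (⊤ ─ A) (λ X → σ ∣ X ∣ * (⟦ r (X ∪ A) ⟧ − ⟦ r A ⟧))
  toℚ-signedBetaContract A = begin
    toℚ (signedBetaContract M A)
      ≡⟨ cong toℚ (signedBeta≡-alternating (⊤ ─ A) (contractRank M A)) ⟩
    toℚ (ℤ.- sumℤ⊆ (⊤ ─ A) (λ X → sign ∣ X ∣ ℤ.* + contractRank M A X))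
      ≡⟨ toℚ-homo‿- (sumℤ⊆ (⊤ ─ A) (λ X → sign ∣ X ∣ ℤ.* + contractRank M A X)) ⟩
    - toℚ (sumℤ⊆ (⊤ ─ A) (λ X → sign ∣ X ∣ ℤ.* + contractRank M A X))
      ≡⟨ cong -_ (toℚ-sumℤ⊆ (⊤ ─ A) (λ X → sign ∣ X ∣ ℤ.* + contractRank M A X)) ⟩
    - Σ⊆ (⊤ ─ A) (λ X → toℚ (sign ∣ X ∣ ℤ.* + contractRank M A X))
      ≡⟨ cong -_ (Σ⊆-cong (⊤ ─ A) λ X → trans (toℚ-homo-* (sign ∣ X ∣) _)
                                              (cong (σ ∣ X ∣ *_) (⟦⟧-∸ (r-mono (q⊆p∪q X A))))) ⟩
    - Σ⊆ (⊤ ─ A) (λ X → σ ∣ X ∣ * (⟦ r (X ∪ A) ⟧ − ⟦ r A ⟧)) ∎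
    where open ≡-Reasoning

  sum≡-rankTransform : sumℚ (λ A → φh ∣ ⊤ ─ A ∣ * toℚ (signedBetaContract M A)) ≡ - rankTransform
  sum≡-rankTransform = begin
    sumℚ (λ A → φh ∣ ⊤ ─ A ∣ * toℚ (signedBetaContract M A))
      ≡⟨ sumℚ≡Σall (λ A → φh ∣ ⊤ ─ A ∣ * toℚ (signedBetaContract M A)) ⟩
    Σall (λ A → φh ∣ ⊤ ─ A ∣ * toℚ (signedBetaContract M A))
      ≡⟨ Σ⊆-cong ⊤ split ⟩
    Σall (λ A → φh ∣ ⊤ ─ A ∣ * I₂ A − φh ∣ ⊤ ─ A ∣ * I₁ A)
      ≡⟨ Σ⊆-− ⊤ (λ A → φh ∣ ⊤ ─ A ∣ * I₂ A) (λ A → φh ∣ ⊤ ─ A ∣ * I₁ A) ⟩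
    Σall (λ A → φh ∣ ⊤ ─ A ∣ * I₂ A) − alternatingSum φh R
      ≡⟨ cong₂ _−_ (Σ⊆-zero ⊤ (λ A → weighted-alternating-constant φh refl (⊤ ─ A) (R A)))
                   (alternatingSum-coefficients φh R) ⟩
    0ℚ − rankTransform
      ≡⟨ ℚP.+-identityˡ (- rankTransform) ⟩
    - rankTransform ∎
    where
    open ≡-Reasoning
    R I₁ I₂ : Subset n → ℚ
    R X = ⟦ r X ⟧
    I₁ A = Σ⊆ (⊤ ─ A) (λ X → σ ∣ X ∣ * R (X ∪ A))
    I₂ A = Σ⊆ (⊤ ─ A) (λ X → σ ∣ X ∣ * R A)
    neg-expand : ∀ c i j → c * - (i − j) ≡ c * j − c * i
    neg-expand = solve 3 (λ c i j → c :* (:- (i :- j)) := c :* j :- c :* i) refl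
    split : ∀ A → φh ∣ ⊤ ─ A ∣ * toℚ (signedBetaContract M A) ≡ φh ∣ ⊤ ─ A ∣ * I₂ A − φh ∣ ⊤ ─ A ∣ * I₁ A
    split A = trans (cong (φh ∣ ⊤ ─ A ∣ *_) (trans (toℚ-signedBetaContract A) (cong -_ (trans
        (Σ⊆-cong (⊤ ─ A) (λ X → *-distribˡ-− (σ ∣ X ∣) (R (X ∪ A)) (R A)))
        (Σ⊆-− (⊤ ─ A) (λ X → σ ∣ X ∣ * R (X ∪ A)) (λ X → σ ∣ X ∣ * R A))))))
      (neg-expand (φh ∣ ⊤ ─ A ∣) (I₁ A) (I₂ A))

  connectivity : Subset n → ℕ
  connectivity Y = r Y ℕ.+ r (⊤ ─ Y) ℕ.∸ r ⊤

  r⊤≤r+r[⊤─Y] : ∀ Y → r ⊤ ℕ.≤ r Y ℕ.+ r (⊤ ─ Y)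
  r⊤≤r+r[⊤─Y] Y = ℕP.≤-trans (ℕP.m≤m+n (r ⊤) (r (Y ∩ (⊤ ─ Y))))
    (subst (λ Z → r Z ℕ.+ r (Y ∩ (⊤ ─ Y)) ℕ.≤ r Y ℕ.+ r (⊤ ─ Y)) (p∪⊤─p≡⊤ Y) (r-submod Y (⊤ ─ Y)))

  ⟦connectivity⟧ : ∀ Y → ⟦ connectivity Y ⟧ ≡ (⟦ r Y ⟧ + ⟦ r (⊤ ─ Y) ⟧) − ⟦ r ⊤ ⟧
  ⟦connectivity⟧ Y = trans (⟦⟧-∸ (r⊤≤r+r[⊤─Y] Y)) (cong (_− ⟦ r ⊤ ⟧) (⟦⟧-+ (r Y) (r (⊤ ─ Y))))

  connectivity-complement : ∀ Y → connectivity (⊤ ─ Y) ≡ connectivity Y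
  connectivity-complement Y rewrite ⊤─⊤─p≡p Y | ℕP.+-comm (r (⊤ ─ Y)) (r Y) = refl

  r⊥≡0 : r ⊥ ≡ 0
  r⊥≡0 = ℕP.n≤0⇒n≡0 (subst (r ⊥ ℕ.≤_) (∣⊥∣≡0 n) (r-bounded ⊥))

  connectivity-⊥ : connectivity ⊥ ≡ 0
  connectivity-⊥ rewrite r⊥≡0 | p─⊥≡p (⊤ {n}) = ℕP.n∸n≡0 (r ⊤)

  connectivity≡0⇒*≤0 : ∀ {Y} x → connectivity Y ≡ 0 → ⟦ connectivity Y ⟧ * x ≤ 0ℚ
  connectivity≡0⇒*≤0 x c≡0 rewrite c≡0 = ℚP.≤-reflexive (ℚP.*-zeroˡ x)

  connectivity*Δφh≤0 : ∀ Y {a b} → ∣ Y ∣ ≡ a → ∣ ⊤ ─ Y ∣ ≡ b → ⟦ connectivity Y ⟧ * Δ φh a b ≤ 0ℚ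
  connectivity*Δφh≤0 Y {zero} {b} ∣Y∣≡0 _ =
    connectivity≡0⇒*≤0 (Δ φh 0 b) (trans (cong connectivity (∣p∣≡0⇒p≡⊥ Y ∣Y∣≡0)) connectivity-⊥)
  connectivity*Δφh≤0 Y {suc a} {zero} _ ∣⊤─Y∣≡0 = connectivity≡0⇒*≤0 (Δ φh (suc a) 0) (begin
    connectivity Y        ≡⟨ connectivity-complement Y ⟨
    connectivity (⊤ ─ Y)  ≡⟨ cong connectivity (∣p∣≡0⇒p≡⊥ (⊤ ─ Y) ∣⊤─Y∣≡0) ⟩
    connectivity ⊥        ≡⟨ connectivity-⊥ ⟩
    0                     ∎)
    where open ≡-Reasoning
  connectivity*Δφh≤0 Y {suc a} {suc b} _ _ = ℚP.≤-trans
    (ℚP.*-monoˡ-≤-nonNeg ⟦ connectivity Y ⟧ {{⟦⟧-nonNeg (connectivity Y)}} (Δφh-nonPos a b))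
    (ℚP.≤-reflexive (ℚP.*-zeroʳ ⟦ connectivity Y ⟧))

  Σall-connectivity*κ : Σall (λ Y → ⟦ connectivity Y ⟧ * κh Y) ≡ rankTransform + rankTransform
  Σall-connectivity*κ = begin
    Σall (λ Y → ⟦ connectivity Y ⟧ * κh Y)
      ≡⟨ Σ⊆-cong ⊤ (λ Y → trans (cong (_* κh Y) (⟦connectivity⟧ Y)) (expand (R Y) (R (⊤ ─ Y)) (R ⊤) (κh Y))) ⟩
    Σall (λ Y → (R Y * κh Y + R (⊤ ─ Y) * κh Y) − R ⊤ * κh Y)
      ≡⟨ Σ⊆-− ⊤ (λ Y → R Y * κh Y + R (⊤ ─ Y) * κh Y) (λ Y → R ⊤ * κh Y) ⟩
    Σall (λ Y → R Y * κh Y + R (⊤ ─ Y) * κh Y) − Σall (λ Y → R ⊤ * κh Y)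
      ≡⟨ cong₂ _−_ (Σ⊆-+ ⊤ (λ Y → R Y * κh Y) (λ Y → R (⊤ ─ Y) * κh Y)) (Σ⊆-*ˡ ⊤ (R ⊤) (κh)) ⟩
    (rankTransform + Σall (λ Y → R (⊤ ─ Y) * κh Y)) − R ⊤ * Σall (κh)
      ≡⟨ cong₂ (λ x y → (rankTransform + x) − R ⊤ * y) complement (Σall-κ {n} φh) ⟩
    (rankTransform + rankTransform) − R ⊤ * 0ℚ
      ≡⟨ drop-zero rankTransform (R ⊤) ⟩
    rankTransform + rankTransform ∎
    where
    open ≡-Reasoning
    R : Subset n → ℚ
    R Y = ⟦ r Y ⟧
    expand : ∀ a b t k → ((a + b) − t) * k ≡ (a * k + b * k) − t * k
    expand = solve 4 (λ a b t k → ((a :+ b) :- t) :* k := (a :* k :+ b :* k) :- t :* k) refl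
    drop-zero : ∀ u t → (u + u) − t * 0ℚ ≡ u + u
    drop-zero = solve 2 (λ u t → (u :+ u) :- t :* con 0ℚ := u :+ u) refl
    complement : Σall (λ Y → R (⊤ ─ Y) * κh Y) ≡ rankTransform
    complement = trans (Σ⊆-cong ⊤ (λ Y → cong (R (⊤ ─ Y) *_) (sym (κφh-complement Y))))
                       (Σall-complement (λ Y → R Y * κh Y))

  rankTransform-nonPos : rankTransform ≤ 0ℚ
  rankTransform-nonPos = ℚP.*-cancelʳ-≤-pos 2ℚ (begin
    rankTransform * 2ℚ                         ≡⟨ double rankTransform ⟨
    rankTransform + rankTransform              ≡⟨ Σall-connectivity*κ ⟨
    Σall (λ Y → ⟦ connectivity Y ⟧ * κh Y)   ≤⟨ Σ⊆-nonPos ⊤ _ (λ Y → connectivity*Δφh≤0 Y refl refl) ⟩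
    0ℚ                                         ≡⟨ ℚP.*-zeroˡ 2ℚ ⟨
    0ℚ * 2ℚ                                    ∎)
    where
    open ℚP.≤-Reasoning
    2ℚ : ℚ
    2ℚ = 1ℚ + 1ℚ
    double : ∀ u → u + u ≡ u * (1ℚ + 1ℚ)
    double = solve 1 (λ u → u :+ u := u :* (con 1ℚ :+ con 1ℚ)) refl

corollary4p10 : (n : ℕ) (M : Matroid n) →
    0ℚ ≤ sumℚ (λ A → h ((+ ∣ ⊤ ─ A ∣) - (+ 1)) * toℚ (signedBetaContract M A))
corollary4p10 n M =
  subst (0ℚ ≤_) (sym (sum≡-rankTransform M)) (ℚP.neg-antimono-≤ (rankTransform-nonPos M))
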